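{- Let $w,v\in\Sigma^\ast$ with $\mathrm{alph}(w)=\mathrm{alph}(v)$ and suppose $w=\alpha_1\,x\,a\,\alpha_2$ and $v=\beta_1\,y\,a\,\beta_2$ with $\alpha_1,\alpha_2,\beta_1,\beta_2,x,y\in\Sigma^\ast$ and $a\in\Sigma$, such that $|x|_c=|y|_c$, $|\alpha_1|_c=|\beta_1|_c$ and $|\alpha_2|_c=|\beta_2|_c$ for all $c\in\Sigma$. Let $w'=\alpha_1\,a\,x\,\alpha_2$ and $v'=\beta_1\,a\,y\,\beta_2$. Then $G(w,v)=G(w',v')$.
   Context: $\Sigma$ is a finite alphabet; $\mathrm{alph}(w)$ is the set of letters occurring in $w$ and $|w|_c$ is the number of occurrences of the letter $c$ in $w$. For letters $c,d$, $\pi_{c,d}$ is the monoid morphism on $\Sigma^\ast$ with $c\mapsto c$, $d\mapsto d$ and all other letters mapped to the empty word. For words $w,v$ with $\mathrm{alph}(w)=\mathrm{alph}(v)=A$, $G(w,v)$ is the undirected simple graph on vertex set $A$ in which distinct $c,d$ are adjacent iff $\pi_{c,d}(w)=\pi_{c,d}(v)$. -}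

module Defs where

open import Data.Nat using (ℕ)
open import Data.Fin using (Fin; _≟_)
open import Data.List using (List; filter; length)
open import Data.Fin.Subset using (Subset; _∈_)
open import Data.Vec using (tabulate)
open import Data.Bool using (Bool)
open import Data.Product using (_×_)
open import Function.Bundles using (_⇔_)
open import Relation.Nullary using (¬_; does)
open import Relation.Nullary.Decidable using (_⊎-dec_)
open import Relation.Binary.PropositionalEquality using (_≡_; _≢_)
open import Data.List.Relation.Unary.Any using (any?)

Word : ℕ → Set
Word n = List (Fin n)

occ : ∀ {n} → Fin n → Word n → ℕ
occ c w = length (filter (c ≟_) w)

alph : ∀ {n} → Word n → Subset n
alph w = tabulate λ c → does (any? (c ≟_) w)

π : ∀ {n} → Fin n → Fin n → Word n → Word n
π c d = filter (λ x → (x ≟ c) ⊎-dec (x ≟ d))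

record Graph (n : ℕ) : Set₁ where
  field
    vertices : Subset n
    Adj      : Fin n → Fin n → Set

open Graph public

G : ∀ {n} → Word n → Word n → Graph n
G w v = record
  { vertices = alph w
  ; Adj = λ c d → (c Data.Fin.Subset.∈ alph w) × (d Data.Fin.Subset.∈ alph w)
                  × (c ≢ d) × (π c d w ≡ π c d v)
  }

_≅G_ : ∀ {n} → Graph n → Graph n → Set
G₁ ≅G G₂ = (vertices G₁ ≡ vertices G₂) × (∀ c d → Adj G₁ c d ⇔ Adj G₂ c d)

{-# OPTIONS --safe #-}
-- For c ≠ d, |π_{c,d}(u)| = |u|_c + |u|_d, so π_{c,d} sends α₁, β₁ and x, y to
-- blocks of equal lengths. As π_{c,d} is a monoid morphism, π_{c,d}(w) = π_{c,d}(v)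
-- and π_{c,d}(w') = π_{c,d}(v') then both amount to the blockwise equalities
-- π_{c,d}(α₁) = π_{c,d}(β₁), π_{c,d}(x) = π_{c,d}(y), π_{c,d}(α₂) = π_{c,d}(β₂).
-- The vertex sets agree because w' is a permutation of w.
module Submission where

open import Defs
open import Data.Nat using (ℕ; suc; _+_; pred)
open import Data.Nat.Properties using (+-suc)
open import Data.Fin using (Fin; _≟_)
open import Data.Fin.Subset using (_∈_)
open import Data.List using (List; _++_; _∷_; []; [_]; length; filter)
open import Data.List.Properties using (filter-++; filter-≐; ++-cancelˡ; ∷-injective)
open import Data.List.Relation.Unary.Any using (any?)
open import Data.List.Relation.Binary.Permutation.Propositional using (_↭_; ↭-sym)
open import Data.List.Relation.Binary.Permutation.Propositional.Properties
  using (shift; ++⁺ˡ; Any-resp-↭)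
open import Data.Vec.Properties using (tabulate-cong)
open import Data.Product using (_×_; _,_)
open import Function.Bundles using (_⇔_; mk⇔; Equivalence)
open import Level using (Level)
open import Relation.Unary using (Pred; Decidable)
open import Relation.Nullary using (¬_; yes; no; contradiction)
open import Relation.Nullary.Decidable using (_⊎-dec_; does-⇔)
open import Relation.Binary.PropositionalEquality
  using (_≡_; _≢_; refl; sym; trans; cong; cong₂; subst; _≗_; module ≡-Reasoning)

module _ {A : Set} where

  ++-injective : (xs ys : List A) {zs ws : List A} → length xs ≡ length ys →
                 xs ++ zs ≡ ys ++ ws → xs ≡ ys × zs ≡ ws
  ++-injective []       []       _   eq = refl , eq
  ++-injective (x ∷ xs) (y ∷ ys) |xs|≡|ys| eq with refl , eq′ ← ∷-injective eq
    with refl , zs≡ws ← ++-injective xs ys (cong pred |xs|≡|ys|) eq′ = refl , zs≡ws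

  swap-middle-≡⇔ : (α₁ β₁ x y l : List A) {α₂ β₂ : List A} →
                   length α₁ ≡ length β₁ → length x ≡ length y →
                   (α₁ ++ x ++ l ++ α₂ ≡ β₁ ++ y ++ l ++ β₂) ⇔
                   (α₁ ++ l ++ x ++ α₂ ≡ β₁ ++ l ++ y ++ β₂)
  swap-middle-≡⇔ α₁ β₁ x y l {α₂} {β₂} |α₁|≡|β₁| |x|≡|y| = mk⇔ to from
    where
    to : α₁ ++ x ++ l ++ α₂ ≡ β₁ ++ y ++ l ++ β₂ → α₁ ++ l ++ x ++ α₂ ≡ β₁ ++ l ++ y ++ β₂
    to eq with refl , eq′ ← ++-injective α₁ β₁ |α₁|≡|β₁| eq
          with refl , eq″ ← ++-injective x y |x|≡|y| eq′
          with refl ← ++-cancelˡ l α₂ β₂ eq″ = refl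

    from : α₁ ++ l ++ x ++ α₂ ≡ β₁ ++ l ++ y ++ β₂ → α₁ ++ x ++ l ++ α₂ ≡ β₁ ++ y ++ l ++ β₂
    from eq with refl , eq′ ← ++-injective α₁ β₁ |α₁|≡|β₁| eq
            with refl , refl ← ++-injective x y |x|≡|y| (++-cancelˡ l (x ++ α₂) (y ++ β₂) eq′)
              = refl

  length-filter-⊎ : {p q : Level} {P : Pred A p} {Q : Pred A q} (P? : Decidable P) (Q? : Decidable Q) →
                    (∀ {z} → P z → ¬ Q z) → (xs : List A) →
                    length (filter (λ z → P? z ⊎-dec Q? z) xs)
                      ≡ length (filter P? xs) + length (filter Q? xs)
  length-filter-⊎ P? Q? disjoint [] = refl
  length-filter-⊎ P? Q? disjoint (x ∷ xs) with ih ← length-filter-⊎ P? Q? disjoint xs | P? x | Q? x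
  ... | yes p | yes q = contradiction q (disjoint p)
  ... | yes _ | no _  = cong suc ih
  ... | no _  | yes _ = trans (cong suc ih) (sym (+-suc _ _))
  ... | no _  | no _  = ih

module _ {n : ℕ} where

  filter-≟-sym : (c : Fin n) → filter (_≟ c) ≗ filter (c ≟_)
  filter-≟-sym c = filter-≐ (_≟ c) (c ≟_) (sym , sym)

  length-π : {c d : Fin n} → c ≢ d → (u : Word n) → length (π c d u) ≡ occ c u + occ d u
  length-π {c} {d} c≢d u = begin
    length (π c d u)
      ≡⟨ length-filter-⊎ (_≟ c) (_≟ d) (λ { refl refl → c≢d refl }) u ⟩
    length (filter (_≟ c) u) + length (filter (_≟ d) u)
      ≡⟨ cong₂ _+_ (cong length (filter-≟-sym c u)) (cong length (filter-≟-sym d u)) ⟩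
    occ c u + occ d u
      ∎
    where open ≡-Reasoning

  length-π-cong : {c d : Fin n} → c ≢ d → (u u′ : Word n) → (∀ e → occ e u ≡ occ e u′) →
                  length (π c d u) ≡ length (π c d u′)
  length-π-cong {c} {d} c≢d u u′ u∼u′ = begin
    length (π c d u)       ≡⟨ length-π c≢d u ⟩
    occ c u + occ d u      ≡⟨ cong₂ _+_ (u∼u′ c) (u∼u′ d) ⟩
    occ c u′ + occ d u′    ≡⟨ length-π c≢d u′ ⟨
    length (π c d u′)      ∎
    where open ≡-Reasoning

  π-++₄ : (c d : Fin n) (u₁ u₂ u₃ u₄ : Word n) →
          π c d (u₁ ++ u₂ ++ u₃ ++ u₄) ≡ π c d u₁ ++ π c d u₂ ++ π c d u₃ ++ π c d u₄
  π-++₄ c d u₁ u₂ u₃ u₄ = begin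
    π c d (u₁ ++ u₂ ++ u₃ ++ u₄)                   ≡⟨ π-++ u₁ _ ⟩
    π c d u₁ ++ π c d (u₂ ++ u₃ ++ u₄)             ≡⟨ cong (π c d u₁ ++_) (π-++ u₂ _) ⟩
    π c d u₁ ++ π c d u₂ ++ π c d (u₃ ++ u₄)       ≡⟨ cong (λ r → π c d u₁ ++ π c d u₂ ++ r) (π-++ u₃ u₄) ⟩
    π c d u₁ ++ π c d u₂ ++ π c d u₃ ++ π c d u₄   ∎
    where
    open ≡-Reasoning
    π-++ : (u u′ : Word n) → π c d (u ++ u′) ≡ π c d u ++ π c d u′
    π-++ = filter-++ (λ z → (z ≟ c) ⊎-dec (z ≟ d))

  π-swap-≡⇔ : (α₁ β₁ x y l α₂ β₂ : Word n) {c d : Fin n} → c ≢ d →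
              (∀ e → occ e α₁ ≡ occ e β₁) → (∀ e → occ e x ≡ occ e y) →
              (π c d (α₁ ++ x ++ l ++ α₂) ≡ π c d (β₁ ++ y ++ l ++ β₂)) ⇔
              (π c d (α₁ ++ l ++ x ++ α₂) ≡ π c d (β₁ ++ l ++ y ++ β₂))
  π-swap-≡⇔ α₁ β₁ x y l α₂ β₂ {c} {d} c≢d α₁∼β₁ x∼y
    rewrite π-++₄ c d α₁ x l α₂ | π-++₄ c d β₁ y l β₂
          | π-++₄ c d α₁ l x α₂ | π-++₄ c d β₁ l y β₂
    = swap-middle-≡⇔ (π c d α₁) (π c d β₁) (π c d x) (π c d y) (π c d l)
        (length-π-cong c≢d α₁ β₁ α₁∼β₁) (length-π-cong c≢d x y x∼y)

  alph-↭ : {u u′ : Word n} → u ↭ u′ → alph u ≡ alph u′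
  alph-↭ u↭u′ = tabulate-cong λ c →
    does-⇔ (mk⇔ (Any-resp-↭ u↭u′) (Any-resp-↭ (↭-sym u↭u′))) (any? (c ≟_) _) (any? (c ≟_) _)

  G-≅ : (w v w′ v′ : Word n) → alph w ≡ alph w′ →
        (∀ c d → c ≢ d → (π c d w ≡ π c d v) ⇔ (π c d w′ ≡ π c d v′)) →
        G w v ≅G G w′ v′
  G-≅ w v w′ v′ alph≡ π⇔ = alph≡ , λ c d → mk⇔ (forth c d) (back c d)
    where
    forth : ∀ c d → Adj (G w v) c d → Adj (G w′ v′) c d
    forth c d (c∈ , d∈ , c≢d , eq) =
      subst (c ∈_) alph≡ c∈ , subst (d ∈_) alph≡ d∈ , c≢d , Equivalence.to (π⇔ c d c≢d) eq

    back : ∀ c d → Adj (G w′ v′) c d → Adj (G w v) c d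
    back c d (c∈ , d∈ , c≢d , eq) =
      subst (c ∈_) (sym alph≡) c∈ , subst (d ∈_) (sym alph≡) d∈ , c≢d , Equivalence.from (π⇔ c d c≢d) eq

-- G reads its vertex set off the first word only, and equal prefixes force
-- equal suffixes.
lemma3 : ∀ {n} (w v α₁ α₂ β₁ β₂ x y : Word n) (a : Fin n) →
    alph w ≡ alph v →
    w ≡ α₁ ++ x ++ a ∷ α₂ →
    v ≡ β₁ ++ y ++ a ∷ β₂ →
    (∀ c → occ c x ≡ occ c y) →
    (∀ c → occ c α₁ ≡ occ c β₁) →
    (∀ c → occ c α₂ ≡ occ c β₂) →
    G w v ≅G G (α₁ ++ a ∷ x ++ α₂) (β₁ ++ a ∷ y ++ β₂)
lemma3 w v α₁ α₂ β₁ β₂ x y a _ refl refl x∼y α₁∼β₁ _ =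
  G-≅ w v w′ v′ (alph-↭ (++⁺ˡ α₁ (shift a x α₂))) π⇔
  where
  w′ v′ : Word _
  w′ = α₁ ++ a ∷ x ++ α₂
  v′ = β₁ ++ a ∷ y ++ β₂

  π⇔ : ∀ c d → c ≢ d → (π c d w ≡ π c d v) ⇔ (π c d w′ ≡ π c d v′)
  π⇔ c d c≢d = π-swap-≡⇔ α₁ β₁ x y [ a ] α₂ β₂ c≢d α₁∼β₁ x∼y
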